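{- Let $M$ be a thread-register model and $\mathcal B$ a set of thread-local actions of $M$. A path $\pi$ of $M$ starting in the initial state of $M$ is $\mathcal B$-$\smile_S$-just if and only if (a) every action $a\notin\mathcal B$ that is thread-enabled by $\pi$ belongs to $\mathit{start}(r)$ for some $r\in\mathbb R$, and (b) if an action $a\in\mathit{start}(r)$ is thread-enabled by $\pi$, then $\pi$ contains infinitely many occurrences of actions of the form $\mathit{sw}_{t',r}(d')$ with $t'\in\mathbb T$, $d'\in D_r$.
   Context: An LTS is a tuple $(S,\mathit{Act},\mathit{init},\mathit{Trans})$ with finite $S$, finite $\mathit{Act}$, $\mathit{init}\in S$, $\mathit{Trans}\subseteq S\times\mathit{Act}\times S$; $a$ is enabled in $s$ if $(s,a,s')\in\mathit{Trans}$ for some $s'$. A path is a nonempty finite or infinite alternating sequence $s_0a_1s_1a_2\ldots$ with $(s_i,a_{i+1},s_{i+1})\in\mathit{Trans}$, ending in a state if finite; a suffix of a path is a path obtained by removing an initial segment ending in a state. The parallel composition of LTSs $P_i=(S_i,\mathit{Act}_i,\mathit{init}_i,\mathit{Trans}_i)$, $i=1..k$, has states $S_1\times\cdots\times S_k$, actions $\bigcup_i\mathit{Act}_i$, initial state $(\mathit{init}_i)_i$, and a transition $((s_i)_i,a,(s'_i)_i)$ iff for every $i$: $s'_i=s_i$ if $a\notin\mathit{Act}_i$, and $(s_i,a,s'_i)\in\mathit{Trans}_i$ if $a\in\mathit{Act}_i$. Registers. Fix disjoint finite sets $\mathbb T$ (thread ids) and $\mathbb R$ (register ids); each $r\in\mathbb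 R$ has a finite domain $D_r$ and initial value $d^0_r$. For $t\in\mathbb T$, $r\in\mathbb R$, $d\in D_r$ the register actions are $\mathit{sr}_{t,r}$, $\mathit{fr}_{t,r}(d)$, $\mathit{sw}_{t,r}(d)$, $\mathit{fw}_{t,r}$ (interface) and $\mathit{or}_{t,r}$, $\mathit{ow}_{t,r}$ (register-local). $\mathit{start}(r)$ is the set of all actions $\mathit{sr}_{t,r}$ and $\mathit{sw}_{t,r}(d)$ with $t\in\mathbb T$, $d\in D_r$. States of a register LTS for $r$ are statuses $s$ with components $\mathit{stor}(s)\in D_r$, $\mathit{rds}(s),\mathit{wrts}(s),\mathit{pend}(s)\subseteq\mathbb T$, and per $t$: $\mathit{rec}(s,t)\in D_r$, $\mathit{ovrl}(s,t)\in\{\mathit{true},\mathit{false}\}$, $\mathit{posv}(s,t)\subseteq D_r$; initially $\mathit{stor}=d^0_r$, $\mathit{rds}=\mathit{wrts}=\mathit{pend}=\emptyset$, $\mathit{rec}(t)=d^0_r$, $\mathit{ovrl}(t)=\mathit{false}$, $\mathit{posv}(t)=\emptyset$. Updates (unmentioned components unchanged, right sides evaluated in $s$): $\mathit{usr}(s,t)$: add $t$ to $\mathit{rds},\mathit{pend}$; $\mathit{ovrl}(t):=(\mathit{wrts}(s)\neq\emptyset)$; $\mathit{posv}(t):=\{\mathit{stor}(s)\}\cup\{\mathit{rec}(s,t'):t'\in\mathit{wrts}(s)\}$. $\mathit{ufr}(s,t)$: remove $t$ from $\mathit{rds}$. $\mathit{usw}(s,t,d)$: add $t$ to $\mathit{wrts},\mathit{pend}$;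 $\mathit{rec}(t):=d$; $\mathit{ovrl}(t):=(\mathit{wrts}(s)\neq\emptyset)$; for all $t'\neq t$: $\mathit{ovrl}(t'):=\mathit{true}$, $\mathit{posv}(t'):=\mathit{posv}(s,t')\cup\{d\}$. $\mathit{ufw}(s,t,d)$: $\mathit{stor}:=d$, remove $t$ from $\mathit{wrts}$. $\mathit{uor}(s,t)$: remove $t$ from $\mathit{pend}$, $\mathit{rec}(t):=\mathit{stor}(s)$. $\mathit{uow}(s,t,d)$: $\mathit{stor}:=d$, remove $t$ from $\mathit{pend}$. In each register LTS, for all $s,t,d$: if $t\notin\mathit{rds}(s)\cup\mathit{wrts}(s)$, transitions $s\xrightarrow{\mathit{sr}_{t,r}}\mathit{usr}(s,t)$ and $s\xrightarrow{\mathit{sw}_{t,r}(d)}\mathit{usw}(s,t,d)$; further: Safe: $t\in\mathit{rds}(s)$, $\neg\mathit{ovrl}(s,t)$: $\mathit{fr}_{t,r}(\mathit{stor}(s))$ to $\mathit{ufr}(s,t)$; $t\in\mathit{rds}(s)$, $\mathit{ovrl}(s,t)$: $\mathit{fr}_{t,r}(d)$ to $\mathit{ufr}(s,t)$; $t\in\mathit{wrts}(s)$, $\neg\mathit{ovrl}(s,t)$: $\mathit{fw}_{t,r}$ to $\mathit{ufw}(s,t,\mathit{rec}(s,t))$; $t\in\mathit{wrts}(s)$, $\mathit{ovrl}(s,t)$: $\mathit{fw}_{t,r}$ to $\mathit{ufw}(s,t,d)$. Regular: $t\in\mathit{rds}(s)$, $d\in\mathit{posv}(s,t)$: $\mathit{fr}_{t,r}(d)$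 to $\mathit{ufr}(s,t)$; $t\in\mathit{wrts}(s)\cap\mathit{pend}(s)$: $\mathit{ow}_{t,r}$ to $\mathit{uow}(s,t,\mathit{rec}(s,t))$; $t\in\mathit{wrts}(s)\setminus\mathit{pend}(s)$: $\mathit{fw}_{t,r}$ to $\mathit{ufw}(s,t,\mathit{stor}(s))$. Atomic: $t\in\mathit{rds}(s)\cap\mathit{pend}(s)$: $\mathit{or}_{t,r}$ to $\mathit{uor}(s,t)$; $t\in\mathit{wrts}(s)\cap\mathit{pend}(s)$: $\mathit{ow}_{t,r}$ to $\mathit{uow}(s,t,\mathit{rec}(s,t))$; $t\in\mathit{rds}(s)\setminus\mathit{pend}(s)$: $\mathit{fr}_{t,r}(\mathit{rec}(s,t))$ to $\mathit{ufr}(s,t)$; $t\in\mathit{wrts}(s)\setminus\mathit{pend}(s)$: $\mathit{fw}_{t,r}$ to $\mathit{ufw}(s,t,\mathit{stor}(s))$. Threads. Each $t\in\mathbb T$ has a thread LTS $T_t$ with actions $\{\mathit{sr}_{t,r},\mathit{fr}_{t,r}(d),\mathit{sw}_{t,r}(d),\mathit{fw}_{t,r}:r\in\mathbb R,d\in D_r\}\cup\mathit{TLoc}_t$, the thread-local sets $\mathit{TLoc}_t$ pairwise disjoint and disjoint from register actions; on every path from its initial state, each $\mathit{sr}_{t,r}$-transition leads to a state where exactly the $\mathit{fr}_{t,r}(d)$, $d\in D_r$, are enabled, each $\mathit{sw}_{t,r}(d)$-transition leads to a state where only $\mathit{fw}_{t,r}$ is enabled, and $\mathit{fr}_{t,r}(d)$,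 $\mathit{fw}_{t,r}$ are enabled only in such states. A thread-register model $M$ is the parallel composition of all $T_t$ and one safe, regular or atomic register LTS per $r\in\mathbb R$; $\mathit{thr}(a)=t$ for every action indexed by $t$ (thread-local actions of $\mathit{TLoc}_t$ included), $\mathit{reg}(a)=r$ for register actions of $r$, $\mathit{reg}(a)=\bot$ for thread-local actions. Justness. $\mathit{sr?}(a)$ iff $a=\mathit{sr}_{t,r}$ for some $t,r$; $\mathit{sw?}(a)$ iff $a=\mathit{sw}_{t,r}(d)$ for some $t,r,d$. $\smile_T=\{(a,b):\mathit{thr}(a)\neq\mathit{thr}(b)\}$, $\smile_S=\smile_T\setminus\{(a,b):(\mathit{sr?}(a)\lor\mathit{sw?}(a))\wedge\mathit{sw?}(b)\wedge\mathit{reg}(a)=\mathit{reg}(b)\}$. A path $\pi$ is $\mathcal B$-$\smile$-just if for every suffix $\pi'$ of $\pi$ and every action $a\notin\mathcal B$ enabled in the first state of $\pi'$, some action $b$ with $\neg(a\smile b)$ occurs in $\pi'$. Thread-enabling. For a path $\pi$ of $M$ from its initial state and $t\in\mathbb T$, if $\pi$ has a suffix on which no action $b$ with $\mathit{thr}(b)=t$ occurs, the $T_t$-component of all states on that suffix is one state $\mathit{end}_t(\pi)$. An action $a$ is thread-enabled by $\pi$ if, for $t=\mathit{thr}(a)$, $\pi$ contains only finitely many actions $b$ with $\mathit{thr}(b)=t$ and $a$ is enabled in $\mathit{end}_t(\pi)$ in $T_t$. -}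

module Defs where

open import Level using (0ℓ)
open import Data.Nat using (ℕ; zero; suc; _≤_; _<_)
open import Data.Fin using (Fin; _≟_)
open import Data.Bool using (Bool; true; false; if_then_else_; _∨_; _∧_; not)
open import Data.List using (List; allFin)
open import Data.Bool.ListAction using (any)
open import Data.Maybe using (Maybe; just; nothing)
open import Data.Product using (Σ; ∃; _×_; _,_)
open import Data.Sum using (_⊎_; inj₁; inj₂)
open import Data.Unit using (⊤)
open import Relation.Nullary using (¬_; Dec; yes; no)
open import Relation.Nullary.Decidable using (⌊_⌋)
open import Relation.Binary.PropositionalEquality using (_≡_; _≢_)
open import Function.Bundles using (_↔_)

record LTS (A : Set) : Set₁ where
  field
    State      : Set
    acts       : A → Set
    init       : State
    Trans      : State → A → State → Set
    trans-acts : ∀ {s a s'} → Trans s a s' → acts a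

module _ {A : Set} (L : LTS A) where
  open LTS L

  Enabled : State → A → Set
  Enabled s a = ∃ λ s' → Trans s a s'

  data Run : State → Set where
    run-init : Run init
    run-step : ∀ {s a s'} → Run s → Trans s a s' → Run s'

  lastAct : ∀ {s} → Run s → Maybe A
  lastAct run-init = nothing
  lastAct (run-step {a = a} _ _) = just a

  FiniteStates : Set
  FiniteStates = Σ ℕ λ n → State ↔ Fin n

compose : {A : Set} {I : Set} → (I → LTS A) → LTS A
compose {A} {I} P = record
  { State = (i : I) → LTS.State (P i)
  ; acts  = λ a → Σ I λ i → LTS.acts (P i) a
  ; init  = λ i → LTS.init (P i)
  ; Trans = λ s a s' → (Σ I λ i → LTS.acts (P i) a) ×
              ((i : I) → (LTS.acts (P i) a → LTS.Trans (P i) (s i) a (s' i))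
                       × (¬ LTS.acts (P i) a → s' i ≡ s i))
  ; trans-acts = λ { (h , _) → h }
  }

-- Paths: finite (fin n = n transitions, states 0..n) or infinite.
-- Action 'act i' labels the transition from 'st i' to 'st (suc i)'.

data Len : Set where
  fin : ℕ → Len
  inf : Len

_<L_ : ℕ → Len → Set
i <L fin n = i < n
i <L inf   = ⊤

_≤L_ : ℕ → Len → Set
i ≤L fin n = i ≤ n
i ≤L inf   = ⊤

record Path {A : Set} (L : LTS A) : Set where
  field
    len  : Len
    st   : ℕ → LTS.State L
    act  : ℕ → A
    step : ∀ i → i <L len → LTS.Trans L (st i) (act i) (st (suc i))

FromInit : {A : Set} {L : LTS A} → Path L → Set
FromInit {L = L} π = Path.st π 0 ≡ LTS.init L

Just : {A : Set} (L : LTS A) (B : A → Set) (_⌣_ : A → A → Set) → Path L → Set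
Just L B _⌣_ π = ∀ k → k ≤L len → ∀ a → ¬ B a → Enabled L (st k) a →
                 ∃ λ i → k ≤ i × i <L len × ¬ (a ⌣ act i)
  where open Path π

-- Signature of a thread-register model: thread ids Fin nT, register ids
-- Fin nR, register domains Fin (dom r) with initial values d0 r, and
-- finite thread-local action sets Fin (nLoc t).

record Sig : Set where
  field
    nT   : ℕ
    nR   : ℕ
    dom  : Fin nR → ℕ
    d0   : (r : Fin nR) → Fin (dom r)
    nLoc : Fin nT → ℕ

data Kind : Set where
  safe regular atomic : Kind

module _ (σ : Sig) where
  open Sig σ

  Th : Set
  Th = Fin nT

  Rg : Set
  Rg = Fin nR

  D : Rg → Set
  D r = Fin (dom r)

  data Act : Set where
    sr  : (t : Th) (r : Rg) → Act
    fr  : (t : Th) (r : Rg) → D r → Act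
    sw  : (t : Th) (r : Rg) → D r → Act
    fw  : (t : Th) (r : Rg) → Act
    or  : (t : Th) (r : Rg) → Act
    ow  : (t : Th) (r : Rg) → Act
    loc : (t : Th) → Fin (nLoc t) → Act

  thr : Act → Th
  thr (sr t r)   = t
  thr (fr t r d) = t
  thr (sw t r d) = t
  thr (fw t r)   = t
  thr (or t r)   = t
  thr (ow t r)   = t
  thr (loc t l)  = t

  reg : Act → Maybe Rg
  reg (sr t r)   = just r
  reg (fr t r d) = just r
  reg (sw t r d) = just r
  reg (fw t r)   = just r
  reg (or t r)   = just r
  reg (ow t r)   = just r
  reg (loc t l)  = nothing

  data IsSr : Act → Set where
    is-sr : ∀ t r → IsSr (sr t r)

  data IsSw : Act → Set where
    is-sw : ∀ t r d → IsSw (sw t r d)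

  data ThreadLocal : Act → Set where
    is-loc : ∀ t l → ThreadLocal (loc t l)

  data ThrAct (t : Th) : Act → Set where
    a-sr  : ∀ r → ThrAct t (sr t r)
    a-fr  : ∀ r d → ThrAct t (fr t r d)
    a-sw  : ∀ r d → ThrAct t (sw t r d)
    a-fw  : ∀ r → ThrAct t (fw t r)
    a-loc : ∀ l → ThrAct t (loc t l)

  data RegAct (r : Rg) : Act → Set where
    a-sr : ∀ t → RegAct r (sr t r)
    a-fr : ∀ t d → RegAct r (fr t r d)
    a-sw : ∀ t d → RegAct r (sw t r d)
    a-fw : ∀ t → RegAct r (fw t r)
    a-or : ∀ t → RegAct r (or t r)
    a-ow : ∀ t → RegAct r (ow t r)

  data Start (r : Rg) : Act → Set where
    st-sr : ∀ t → Start r (sr t r)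
    st-sw : ∀ t d → Start r (sw t r d)

  _⌣T_ : Act → Act → Set
  a ⌣T b = thr a ≢ thr b

  _⌣S_ : Act → Act → Set
  a ⌣S b = thr a ≢ thr b × ¬ ((IsSr a ⊎ IsSw a) × IsSw b × reg a ≡ reg b)

  -- Register statuses (subsets of threads as characteristic functions)

  record Status (r : Rg) : Set where
    field
      stor : D r
      rds  : Th → Bool
      wrts : Th → Bool
      pend : Th → Bool
      rec  : Th → D r
      ovrl : Th → Bool
      posv : Th → D r → Bool

  open Status

  upd : {B : Set} → (Th → B) → Th → B → Th → B
  upd f t v t' = if ⌊ t' ≟ t ⌋ then v else f t'

  nonEmpty : (Th → Bool) → Bool
  nonEmpty f = any f (allFin nT)

  initStatus : (r : Rg) → Status r
  initStatus r = record
    { stor = d0 r ; rds = λ _ → false ; wrts = λ _ → false ; pend = λ _ → false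
    ; rec = λ _ → d0 r ; ovrl = λ _ → false ; posv = λ _ _ → false }

  module _ {r : Rg} where
    usr : Status r → Th → Status r
    usr s t = record s
      { rds  = upd (rds s) t true
      ; pend = upd (pend s) t true
      ; ovrl = upd (ovrl s) t (nonEmpty (wrts s))
      ; posv = upd (posv s) t (λ d → ⌊ d ≟ stor s ⌋ ∨
                                   any (λ t' → wrts s t' ∧ ⌊ rec s t' ≟ d ⌋) (allFin nT)) }

    ufr : Status r → Th → Status r
    ufr s t = record s { rds = upd (rds s) t false }

    usw : Status r → Th → D r → Status r
    usw s t d = record s
      { wrts = upd (wrts s) t true
      ; pend = upd (pend s) t true
      ; rec  = upd (rec s) t d
      ; ovrl = upd (λ _ → true) t (nonEmpty (wrts s))
      ; posv = upd (λ t' d' → posv s t' d' ∨ ⌊ d' ≟ d ⌋) t (posv s t) }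

    ufw : Status r → Th → D r → Status r
    ufw s t d = record s { stor = d ; wrts = upd (wrts s) t false }

    uor : Status r → Th → Status r
    uor s t = record s { pend = upd (pend s) t false ; rec = upd (rec s) t (stor s) }

    uow : Status r → Th → D r → Status r
    uow s t d = record s { stor = d ; pend = upd (pend s) t false }

  data RTrans (r : Rg) : Kind → Status r → Act → Status r → Set where
    t-sr : ∀ {k s t} → rds s t ≡ false → wrts s t ≡ false →
           RTrans r k s (sr t r) (usr s t)
    t-sw : ∀ {k s t} d → rds s t ≡ false → wrts s t ≡ false →
           RTrans r k s (sw t r d) (usw s t d)
    s-fr₁ : ∀ {s t} → rds s t ≡ true → ovrl s t ≡ false →
            RTrans r safe s (fr t r (stor s)) (ufr s t)
    s-fr₂ : ∀ {s t} d → rds s t ≡ true → ovrl s t ≡ true →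
            RTrans r safe s (fr t r d) (ufr s t)
    s-fw₁ : ∀ {s t} → wrts s t ≡ true → ovrl s t ≡ false →
            RTrans r safe s (fw t r) (ufw s t (rec s t))
    s-fw₂ : ∀ {s t} d → wrts s t ≡ true → ovrl s t ≡ true →
            RTrans r safe s (fw t r) (ufw s t d)
    r-fr : ∀ {s t} d → rds s t ≡ true → posv s t d ≡ true →
           RTrans r regular s (fr t r d) (ufr s t)
    r-ow : ∀ {s t} → wrts s t ≡ true → pend s t ≡ true →
           RTrans r regular s (ow t r) (uow s t (rec s t))
    r-fw : ∀ {s t} → wrts s t ≡ true → pend s t ≡ false →
           RTrans r regular s (fw t r) (ufw s t (stor s))
    a-or : ∀ {s t} → rds s t ≡ true → pend s t ≡ true →
           RTrans r atomic s (or t r) (uor s t)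
    a-ow : ∀ {s t} → wrts s t ≡ true → pend s t ≡ true →
           RTrans r atomic s (ow t r) (uow s t (rec s t))
    a-fr : ∀ {s t} → rds s t ≡ true → pend s t ≡ false →
           RTrans r atomic s (fr t r (rec s t)) (ufr s t)
    a-fw : ∀ {s t} → wrts s t ≡ true → pend s t ≡ false →
           RTrans r atomic s (fw t r) (ufw s t (stor s))

  RTrans-acts : ∀ {r k s a s'} → RTrans r k s a s' → RegAct r a
  RTrans-acts (t-sr {t = t} _ _) = a-sr t
  RTrans-acts (t-sw {t = t} d _ _) = a-sw t d
  RTrans-acts (s-fr₁ {s = s} {t} _ _) = a-fr t (stor s)
  RTrans-acts (s-fr₂ {t = t} d _ _) = a-fr t d
  RTrans-acts (s-fw₁ {t = t} _ _) = a-fw t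
  RTrans-acts (s-fw₂ {t = t} _ _ _) = a-fw t
  RTrans-acts (r-fr {t = t} d _ _) = a-fr t d
  RTrans-acts (r-ow {t = t} _ _) = a-ow t
  RTrans-acts (r-fw {t = t} _ _) = a-fw t
  RTrans-acts (a-or {t = t} _ _) = a-or t
  RTrans-acts (a-ow {t = t} _ _) = a-ow t
  RTrans-acts (a-fr {s = s} {t} _ _) = a-fr t (rec s t)
  RTrans-acts (a-fw {t = t} _ _) = a-fw t

  RegisterLTS : Rg → Kind → LTS Act
  RegisterLTS r k = record
    { State = Status r ; acts = RegAct r ; init = initStatus r
    ; Trans = RTrans r k ; trans-acts = RTrans-acts }

  IsThread : (t : Th) → LTS Act → Set
  IsThread t L =
    FiniteStates L ×
    (∀ a → (LTS.acts L a → ThrAct t a) × (ThrAct t a → LTS.acts L a)) ×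
    (∀ {s} (ρ : Run L s) (r : Rg) →
       (lastAct L ρ ≡ just (sr t r) →
          (∀ d → Enabled L s (fr t r d)) × (∀ b → Enabled L s b → ∃ λ d → b ≡ fr t r d)) ×
       (∀ d → lastAct L ρ ≡ just (sw t r d) →
          Enabled L s (fw t r) × (∀ b → Enabled L s b → b ≡ fw t r)) ×
       (∀ d → Enabled L s (fr t r d) → lastAct L ρ ≡ just (sr t r)) ×
       (Enabled L s (fw t r) → ∃ λ d → lastAct L ρ ≡ just (sw t r d)))

  Component : ((t : Th) → LTS Act) → (Rg → Kind) → Th ⊎ Rg → LTS Act
  Component T kind (inj₁ t) = T t
  Component T kind (inj₂ r) = RegisterLTS r (kind r)

  Model : ((t : Th) → LTS Act) → (Rg → Kind) → LTS Act
  Model T kind = compose (Component T kind)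

  module _ (T : (t : Th) → LTS Act) (kind : Rg → Kind) where
    open Path

    -- π contains only finitely many actions of thread t from position N on,
    -- i.e. the suffix from N contains no action of thread t
    NoThreadActFrom : Path (Model T kind) → Th → ℕ → Set
    NoThreadActFrom π t N = N ≤L len π × (∀ i → N ≤ i → i <L len π → thr (act π i) ≢ t)

    -- a is thread-enabled by π: finitely many thr(a)-actions in π, and a is
    -- enabled in end_{thr(a)}(π) (the T_{thr a}-component of the final suffix)
    ThreadEnabled : Path (Model T kind) → Act → Set
    ThreadEnabled π a = ∃ λ N → NoThreadActFrom π (thr a) N ×
                        Enabled (T (thr a)) (st π N (inj₁ (thr a))) a

    InfManySw : Path (Model T kind) → Rg → Set
    InfManySw π r = ∀ N → ∃ λ i → N ≤ i × i <L len π ×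
                    Σ Th λ t' → Σ (D r) λ d' → act π i ≡ sw t' r d'

-- Along a path from the initial state the registers stay in step with the threads: register
-- r records t as reading (writing) exactly when t's last action was sr (sw) on r, and every
-- reader of a regular register has a possible value to return. Hence a thread enabling fr
-- (fw) has a pending operation, for which the model enables a finishing action of that
-- thread (fr, fw, or or ow), and a thread enabling a start action on r is idle on r, so the
-- model enables that start action. Finishing and thread-local actions ⌣S-conflict only with
-- actions of their own thread; a start action on r also conflicts with every sw on r. So
-- once a thread has stopped, justness lets it enable only start actions, and a start action
-- on r only while sw's on r keep occurring. Conversely, an enabled or/ow witnesses a pending
-- operation, i.e. a thread-enabled fr/fw, which condition (a) rules out.
module Submission where

open import Defs
open import Level using (0ℓ)
open import Axiom.ExcludedMiddle using (ExcludedMiddle)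
open import Axiom.DoubleNegationElimination using (em⇒dne)
open import Data.Bool using (true; false; _∨_)
open import Data.Bool.Properties using (not-¬; ¬-not)
open import Data.Empty using (⊥-elim)
open import Data.Fin using (_≟_)
open import Data.Maybe using (Maybe; just)
open import Data.Nat using (ℕ; zero; suc; _≤_; _≤′_; ≤′-refl; ≤′-step; _⊔_)
open import Data.Nat.Properties
  using (≤-refl; ≤-trans; <⇒≤; ≤⇒≯; ≤⇒≤′; ≤′⇒≤; m≤m⊔n; m≤n⊔m)
open import Data.Product using (Σ; ∃; _×_; _,_; proj₁; proj₂)
open import Data.Sum using (_⊎_; inj₁; inj₂; [_,_])
open import Data.Unit using (tt)
open import Function using (case_of_)
open import Function.Bundles using (_⇔_; mk⇔)
open import Relation.Nullary using (¬_; Dec; yes; no)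
open import Relation.Nullary.Decidable using (isYes≗does; dec-true)
open import Relation.Binary.PropositionalEquality
  using (_≡_; _≢_; refl; sym; trans; subst; ≢-sym)

∨-introˡ : ∀ {x y} → x ≡ true → x ∨ y ≡ true
∨-introˡ refl = refl

<L⇒≤L : ∀ {n} l → n <L l → n ≤L l
<L⇒≤L (fin m) n<m = <⇒≤ n<m
<L⇒≤L inf     _   = tt

suc-≤L⇒<L : ∀ {n} l → suc n ≤L l → n <L l
suc-≤L⇒<L (fin m) n<m = n<m
suc-≤L⇒<L inf     _   = tt

OccursAfter : Len → (ℕ → Set) → ℕ → Set
OccursAfter l P M = ∃ λ i → M ≤ i × i <L l × P i

occursAfter-from : ∀ {P N} l → N ≤L l →
                   (∀ K → N ≤ K → K ≤L l → OccursAfter l P K) → ∀ M → OccursAfter l P M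
occursAfter-from (fin n) N≤n later _ with later n N≤n ≤-refl
... | i , n≤i , i<n , _ = ⊥-elim (≤⇒≯ n≤i i<n)
occursAfter-from {N = N} inf _ later M with later (M ⊔ N) (m≤n⊔m M N) tt
... | i , M⊔N≤i , i<l , p = i , ≤-trans (m≤m⊔n M N) M⊔N≤i , i<l , p

lastAct-subst : ∀ {A} {L : LTS A} {s s'} (e : s ≡ s') (ρ : Run L s) →
                lastAct L (subst (Run L) e ρ) ≡ lastAct L ρ
lastAct-subst refl ρ = refl

reachable-along : ∀ {A} {L : LTS A} (π : Path L) → FromInit π →
                  ∀ n → n ≤L Path.len π → Run L (Path.st π n)
reachable-along {L = L} π fromInit zero _ = subst (Run L) (sym fromInit) run-init
reachable-along π fromInit (suc n) n<l =
  run-step (reachable-along π fromInit n (<L⇒≤L (Path.len π) n<)) (Path.step π n n<)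
  where
  n< : n <L Path.len π
  n< = suc-≤L⇒<L (Path.len π) n<l

module _ {A I : Set} (P : I → LTS A) where
  open LTS using (State; acts; Trans)

  enabled-component : ∀ {s a} → Enabled (compose P) s a →
                      ∀ i → acts (P i) a → Enabled (P i) (s i) a
  enabled-component (s' , _ , moves) i a∈i = s' i , proj₁ (moves i) a∈i

  enabled-compose : ExcludedMiddle 0ℓ → ∀ {s a} → (∃ λ i → acts (P i) a) →
                    (∀ i → acts (P i) a → Enabled (P i) (s i) a) → Enabled (compose P) s a
  enabled-compose em {s} {a} participant enabled =
    (λ i → target i em) , participant , λ i → moves i em
    where
    target : ∀ i → Dec (acts (P i) a) → State (P i)
    target i (yes a∈i) = proj₁ (enabled i a∈i)
    target i (no _)    = s i
    moves : ∀ i (a∈i? : Dec (acts (P i) a)) →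
            (acts (P i) a → Trans (P i) (s i) a (target i a∈i?)) ×
            (¬ acts (P i) a → target i a∈i? ≡ s i)
    moves i (yes a∈i) = (λ _ → proj₂ (enabled i a∈i)) , (λ a∉i → ⊥-elim (a∉i a∈i))
    moves i (no a∉i)  = (λ a∈i → ⊥-elim (a∉i a∈i)) , (λ _ → refl)

  component-step : ExcludedMiddle 0ℓ → ∀ {s a s'} → Trans (compose P) s a s' → ∀ i →
                   Trans (P i) (s i) a (s' i) ⊎ (¬ acts (P i) a × s' i ≡ s i)
  component-step em {a = a} (_ , moves) i with em {acts (P i) a}
  ... | yes a∈i = inj₁ (proj₁ (moves i) a∈i)
  ... | no a∉i  = inj₂ (a∉i , proj₂ (moves i) a∉i)

  component-frozen : (π : Path (compose P)) (i : I) {N K : ℕ} →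
    (∀ j → N ≤ j → j <L Path.len π → ¬ acts (P i) (Path.act π j)) →
    N ≤ K → K ≤L Path.len π → Path.st π K i ≡ Path.st π N i
  component-frozen π i {N} idle N≤K = frozen (≤⇒≤′ N≤K)
    where
    open Path π
    frozen : ∀ {K} → N ≤′ K → K ≤L len → st K i ≡ st N i
    frozen ≤′-refl _ = refl
    frozen (≤′-step {K} N≤′K) K<l =
      trans (proj₂ (proj₂ (step K K<) i) (idle K (≤′⇒≤ N≤′K) K<))
            (frozen N≤′K (<L⇒≤L len K<))
      where
      K< : K <L len
      K< = suc-≤L⇒<L len K<l

module _ {σ : Sig} where
  open Status

  thr-ThrAct : ∀ {t b} → ThrAct σ t b → thr σ b ≡ t
  thr-ThrAct (a-sr _)   = refl
  thr-ThrAct (a-fr _ _) = refl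
  thr-ThrAct (a-sw _ _) = refl
  thr-ThrAct (a-fw _)   = refl
  thr-ThrAct (a-loc _)  = refl

  start-not-local : ∀ {r a} → Start σ r a → ¬ ThreadLocal σ a
  start-not-local (st-sr _)   ()
  start-not-local (st-sw _ _) ()

  SwOn : Rg σ → Act σ → Set
  SwOn r b = Σ (Th σ) λ t → Σ (D σ r) λ d → b ≡ sw t r d

  start-⌣S : ∀ {r a b} → Start σ r a → thr σ a ≢ thr σ b → ¬ SwOn r b → _⌣S_ σ a b
  start-⌣S (st-sr _)   a≢b ¬sw = a≢b , λ { (_ , is-sw t _ d , refl) → ¬sw (t , d , refl) }
  start-⌣S (st-sw _ _) a≢b ¬sw = a≢b , λ { (_ , is-sw t _ d , refl) → ¬sw (t , d , refl) }

  start-¬⌣S-sw : ∀ {r a b} → Start σ r a → SwOn r b → ¬ _⌣S_ σ a b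
  start-¬⌣S-sw (st-sr t)   (_ , _ , refl) (_ , ¬conflict) =
    ¬conflict (inj₁ (is-sr t _) , is-sw _ _ _ , refl)
  start-¬⌣S-sw (st-sw t d) (_ , _ , refl) (_ , ¬conflict) =
    ¬conflict (inj₂ (is-sw t _ d) , is-sw _ _ _ , refl)

  data NonStart (t : Th σ) : Act σ → Set where
    ns-fr  : ∀ r d → NonStart t (fr t r d)
    ns-fw  : ∀ r → NonStart t (fw t r)
    ns-or  : ∀ r → NonStart t (or t r)
    ns-ow  : ∀ r → NonStart t (ow t r)
    ns-loc : ∀ l → NonStart t (loc t l)

  nonStart-⌣S : ∀ {t b c} → NonStart t b → thr σ c ≢ t → _⌣S_ σ b c
  nonStart-⌣S (ns-fr _ _) c≢t = ≢-sym c≢t , λ { (inj₁ () , _) ; (inj₂ () , _) }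
  nonStart-⌣S (ns-fw _)   c≢t = ≢-sym c≢t , λ { (inj₁ () , _) ; (inj₂ () , _) }
  nonStart-⌣S (ns-or _)   c≢t = ≢-sym c≢t , λ { (inj₁ () , _) ; (inj₂ () , _) }
  nonStart-⌣S (ns-ow _)   c≢t = ≢-sym c≢t , λ { (inj₁ () , _) ; (inj₂ () , _) }
  nonStart-⌣S (ns-loc _)  c≢t = ≢-sym c≢t , λ { (inj₁ () , _) ; (inj₂ () , _) }

  upd-self : ∀ {B : Set} (f : Th σ → B) t v → upd σ f t v t ≡ v
  upd-self f t v with t ≟ t
  ... | yes _  = refl
  ... | no t≢t = ⊥-elim (t≢t refl)

  upd-other : ∀ {B : Set} (f : Th σ → B) {t t'} v → t ≢ t' → upd σ f t' v t ≡ f t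
  upd-other f {t} {t'} v t≢t' with t ≟ t'
  ... | yes t≡t' = ⊥-elim (t≢t' t≡t')
  ... | no _     = refl

  module _ {r : Rg σ} where

    RTrans-preserves-other : ∀ {k s b s' t} → RTrans σ r k s b s' → ¬ ThrAct σ t b →
                             rds s' t ≡ rds s t × wrts s' t ≡ wrts s t
    RTrans-preserves-other {s = s} (t-sr _ _) ¬tb =
      upd-other (rds s) true (λ { refl → ¬tb (a-sr _) }) , refl
    RTrans-preserves-other {s = s} (t-sw d _ _) ¬tb =
      refl , upd-other (wrts s) true (λ { refl → ¬tb (a-sw _ d) })
    RTrans-preserves-other {s = s} (s-fr₁ _ _) ¬tb =
      upd-other (rds s) false (λ { refl → ¬tb (a-fr _ _) }) , refl
    RTrans-preserves-other {s = s} (s-fr₂ _ _ _) ¬tb =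
      upd-other (rds s) false (λ { refl → ¬tb (a-fr _ _) }) , refl
    RTrans-preserves-other {s = s} (r-fr _ _ _) ¬tb =
      upd-other (rds s) false (λ { refl → ¬tb (a-fr _ _) }) , refl
    RTrans-preserves-other {s = s} (a-fr _ _) ¬tb =
      upd-other (rds s) false (λ { refl → ¬tb (a-fr _ _) }) , refl
    RTrans-preserves-other {s = s} (s-fw₁ _ _) ¬tb =
      refl , upd-other (wrts s) false (λ { refl → ¬tb (a-fw _) })
    RTrans-preserves-other {s = s} (s-fw₂ _ _ _) ¬tb =
      refl , upd-other (wrts s) false (λ { refl → ¬tb (a-fw _) })
    RTrans-preserves-other {s = s} (r-fw _ _) ¬tb =
      refl , upd-other (wrts s) false (λ { refl → ¬tb (a-fw _) })
    RTrans-preserves-other {s = s} (a-fw _ _) ¬tb =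
      refl , upd-other (wrts s) false (λ { refl → ¬tb (a-fw _) })
    RTrans-preserves-other (r-ow _ _) _ = refl , refl
    RTrans-preserves-other (a-ow _ _) _ = refl , refl
    RTrans-preserves-other (a-or _ _) _ = refl , refl

    ReadersHaveValues : Status σ r → Set
    ReadersHaveValues s = ∀ t → rds s t ≡ true → ∃ λ d → posv s t d ≡ true

    private
      ufr-readersHaveValues : ∀ s t → ReadersHaveValues s → ReadersHaveValues (ufr σ s t)
      ufr-readersHaveValues _ t' ok t reading with t ≟ t'
      ... | yes refl = case reading of λ ()
      ... | no _     = ok t reading

    -- A new reader may return the stored value; a write only adds possible values.
    RTrans-readersHaveValues : ∀ {k s b s'} → RTrans σ r k s b s' →
                               ReadersHaveValues s → ReadersHaveValues s'
    RTrans-readersHaveValues {s = s} (t-sr {t = t'} _ _) ok t reading with t ≟ t'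
    ... | no _     = ok t reading
    ... | yes refl = stor s , ∨-introˡ (trans (isYes≗does stored?) (dec-true stored? refl))
      where
      stored? : Dec (stor s ≡ stor s)
      stored? = stor s ≟ stor s
    RTrans-readersHaveValues (t-sw {t = t'} _ _ _) ok t reading with t ≟ t' | ok t reading
    ... | yes refl | d , p = d , p
    ... | no _     | d , p = d , ∨-introˡ p
    RTrans-readersHaveValues {s = s} (s-fr₁ {t = t} _ _)   = ufr-readersHaveValues s t
    RTrans-readersHaveValues {s = s} (s-fr₂ {t = t} _ _ _) = ufr-readersHaveValues s t
    RTrans-readersHaveValues {s = s} (r-fr {t = t} _ _ _)  = ufr-readersHaveValues s t
    RTrans-readersHaveValues {s = s} (a-fr {t = t} _ _)    = ufr-readersHaveValues s t
    RTrans-readersHaveValues (s-fw₁ _ _)   ok = ok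
    RTrans-readersHaveValues (s-fw₂ _ _ _) ok = ok
    RTrans-readersHaveValues (r-fw _ _)    ok = ok
    RTrans-readersHaveValues (a-fw _ _)    ok = ok
    RTrans-readersHaveValues (r-ow _ _)    ok = ok
    RTrans-readersHaveValues (a-ow _ _)    ok = ok
    RTrans-readersHaveValues (a-or _ _)    ok = ok

    reading-can-finish : ∀ {t} k {s : Status σ r} → ReadersHaveValues s → rds s t ≡ true →
                         (∃ λ d → Enabled (RegisterLTS σ r k) s (fr t r d)) ⊎
                         Enabled (RegisterLTS σ r k) s (or t r)
    reading-can-finish {t} safe {s} _ reading with ovrl s t in overlapped
    ... | false = inj₁ (_ , _ , s-fr₁ reading overlapped)
    ... | true  = inj₁ (_ , _ , s-fr₂ (stor s) reading overlapped)
    reading-can-finish {t} regular ok reading with ok t reading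
    ... | d , possible = inj₁ (_ , _ , r-fr d reading possible)
    reading-can-finish {t} atomic {s} _ reading with pend s t in pending
    ... | false = inj₁ (_ , _ , a-fr reading pending)
    ... | true  = inj₂ (_ , a-or reading pending)

    writing-can-finish : ∀ {t} k {s : Status σ r} → wrts s t ≡ true →
                         Enabled (RegisterLTS σ r k) s (fw t r) ⊎
                         Enabled (RegisterLTS σ r k) s (ow t r)
    writing-can-finish {t} safe {s} writing with ovrl s t in overlapped
    ... | false = inj₁ (_ , s-fw₁ writing overlapped)
    ... | true  = inj₁ (_ , s-fw₂ (stor s) writing overlapped)
    writing-can-finish {t} regular {s} writing with pend s t in pending
    ... | false = inj₁ (_ , r-fw writing pending)
    ... | true  = inj₂ (_ , r-ow writing pending)
    writing-can-finish {t} atomic {s} writing with pend s t in pending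
    ... | false = inj₁ (_ , a-fw writing pending)
    ... | true  = inj₂ (_ , a-ow writing pending)

    or⇒reading : ∀ {k s t s'} → RTrans σ r k s (or t r) s' → rds s t ≡ true
    or⇒reading (a-or reading _) = reading

    ow⇒writing : ∀ {k s t s'} → RTrans σ r k s (ow t r) s' → wrts s t ≡ true
    ow⇒writing (r-ow writing _) = writing
    ow⇒writing (a-ow writing _) = writing

  record InSync (r : Rg σ) (t : Th σ) (s : Status σ r) (last : Maybe (Act σ)) : Set where
    field
      reading⇒sr : rds s t ≡ true → last ≡ just (sr t r)
      sr⇒reading : last ≡ just (sr t r) → rds s t ≡ true
      writing⇒sw : wrts s t ≡ true → ∃ λ d → last ≡ just (sw t r d)
      sw⇒writing : ∀ {d} → last ≡ just (sw t r d) → wrts s t ≡ true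

  open InSync

  module _ {r : Rg σ} {t : Th σ} where

    InSync-cong : ∀ {s s' last} → rds s' t ≡ rds s t → wrts s' t ≡ wrts s t →
                  InSync r t s last → InSync r t s' last
    InSync-cong same-rds same-wrts sync = record
      { reading⇒sr = λ reading → reading⇒sr sync (trans (sym same-rds) reading)
      ; sr⇒reading = λ last → trans same-rds (sr⇒reading sync last)
      ; writing⇒sw = λ writing → writing⇒sw sync (trans (sym same-wrts) writing)
      ; sw⇒writing = λ last → trans same-wrts (sw⇒writing sync last)
      }

    sync-idle : ∀ {s last} → rds s t ≡ false → wrts s t ≡ false →
                last ≢ just (sr t r) → (∀ {d} → last ≢ just (sw t r d)) → InSync r t s last
    sync-idle not-reading not-writing not-sr not-sw = record
      { reading⇒sr = λ reading → ⊥-elim (not-¬ not-reading reading)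
      ; sr⇒reading = λ last → ⊥-elim (not-sr last)
      ; writing⇒sw = λ writing → ⊥-elim (not-¬ not-writing writing)
      ; sw⇒writing = λ last → ⊥-elim (not-sw last)
      }

    private
      sync-after-fr : ∀ {s d} → (wrts s t ≡ true → fr {σ} t r d ≡ fw t r) →
                      InSync r t (ufr σ s t) (just (fr t r d))
      sync-after-fr {s} writing =
        sync-idle (upd-self (rds s) t false) (¬-not λ wr → case writing wr of λ ()) (λ ()) (λ ())

      sync-after-fw : ∀ s d → (rds s t ≡ true → ∃ λ d' → fw {σ} t r ≡ fr t r d') →
                      InSync r t (ufw σ s t d) (just (fw t r))
      sync-after-fw s _ reading =
        sync-idle (¬-not λ rd → case reading rd of λ ()) (upd-self (wrts s) t false) (λ ()) (λ ())

    RespectsPending : Status σ r → Act σ → Set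
    RespectsPending s b =
      (rds s t ≡ true → ∃ λ d → b ≡ fr t r d) × (wrts s t ≡ true → b ≡ fw t r)

    sync-own-step : ∀ {k s b s'} → RTrans σ r k s b s' → ThrAct σ t b → RespectsPending s b →
                    InSync r t s' (just b)
    sync-own-step {s = s} (t-sr _ not-writing) (a-sr _) _ = record
      { reading⇒sr = λ _ → refl
      ; sr⇒reading = λ _ → upd-self (rds s) t true
      ; writing⇒sw = λ writing → ⊥-elim (not-¬ not-writing writing)
      ; sw⇒writing = λ ()
      }
    sync-own-step {s = s} (t-sw d not-reading _) (a-sw _ _) _ = record
      { reading⇒sr = λ reading → ⊥-elim (not-¬ not-reading reading)
      ; sr⇒reading = λ ()
      ; writing⇒sw = λ _ → d , refl
      ; sw⇒writing = λ _ → upd-self (wrts s) t true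
      }
    sync-own-step (s-fr₁ _ _)   (a-fr _ _) (_ , writing) = sync-after-fr writing
    sync-own-step (s-fr₂ _ _ _) (a-fr _ _) (_ , writing) = sync-after-fr writing
    sync-own-step (r-fr _ _ _)  (a-fr _ _) (_ , writing) = sync-after-fr writing
    sync-own-step (a-fr _ _)    (a-fr _ _) (_ , writing) = sync-after-fr writing
    sync-own-step {s = s} (s-fw₁ _ _)   (a-fw _) (reading , _) = sync-after-fw s (rec s t) reading
    sync-own-step {s = s} (s-fw₂ d _ _) (a-fw _) (reading , _) = sync-after-fw s d reading
    sync-own-step {s = s} (r-fw _ _)    (a-fw _) (reading , _) = sync-after-fw s (stor s) reading
    sync-own-step {s = s} (a-fw _ _)    (a-fw _) (reading , _) = sync-after-fw s (stor s) reading

    sync-foreign-step : ∀ {s b} → ¬ RegAct σ r b → RespectsPending s b → InSync r t s (just b)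
    sync-foreign-step b∉r (reading , writing) = sync-idle
      (¬-not λ rd → case reading rd of λ { (d , refl) → b∉r (a-fr _ d) })
      (¬-not λ wr → case writing wr of λ { refl → b∉r (a-fw _) })
      (λ { refl → b∉r (a-sr _) })
      (λ { refl → b∉r (a-sw _ _) })

module ThreadProtocol {σ : Sig} {t : Th σ} {L : LTS (Act σ)} (isT : IsThread σ t L) where

  acts⇒ThrAct : ∀ {a} → LTS.acts L a → ThrAct σ t a
  acts⇒ThrAct {a} = proj₁ (proj₁ (proj₂ isT) a)

  ThrAct⇒acts : ∀ {a} → ThrAct σ t a → LTS.acts L a
  ThrAct⇒acts {a} = proj₂ (proj₁ (proj₂ isT) a)

  enabled⇒ThrAct : ∀ {s a} → Enabled L s a → ThrAct σ t a
  enabled⇒ThrAct (_ , step) = acts⇒ThrAct (LTS.trans-acts L step)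

  module _ {s} (ρ : Run L s) (r : Rg σ) where

    after-sr-fr-enabled : lastAct L ρ ≡ just (sr t r) → ∀ d → Enabled L s (fr t r d)
    after-sr-fr-enabled last = proj₁ (proj₁ (proj₂ (proj₂ isT) ρ r) last)

    after-sr-only-fr : lastAct L ρ ≡ just (sr t r) →
                       ∀ b → Enabled L s b → ∃ λ d → b ≡ fr t r d
    after-sr-only-fr last = proj₂ (proj₁ (proj₂ (proj₂ isT) ρ r) last)

    after-sw-fw-enabled : ∀ {d} → lastAct L ρ ≡ just (sw t r d) → Enabled L s (fw t r)
    after-sw-fw-enabled last = proj₁ (proj₁ (proj₂ (proj₂ (proj₂ isT) ρ r)) _ last)

    after-sw-only-fw : ∀ {d} → lastAct L ρ ≡ just (sw t r d) →
                       ∀ b → Enabled L s b → b ≡ fw t r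
    after-sw-only-fw last = proj₂ (proj₁ (proj₂ (proj₂ (proj₂ isT) ρ r)) _ last)

    fr-enabled⇒after-sr : ∀ {d} → Enabled L s (fr t r d) → lastAct L ρ ≡ just (sr t r)
    fr-enabled⇒after-sr = proj₁ (proj₂ (proj₂ (proj₂ (proj₂ isT) ρ r))) _

    fw-enabled⇒after-sw : Enabled L s (fw t r) → ∃ λ d → lastAct L ρ ≡ just (sw t r d)
    fw-enabled⇒after-sw = proj₂ (proj₂ (proj₂ (proj₂ (proj₂ isT) ρ r)))

module ThreadRegisterModel (em : ExcludedMiddle 0ℓ) (σ : Sig) (T : Th σ → LTS (Act σ))
                           (isT : ∀ t → IsThread σ t (T t)) (kind : Rg σ → Kind) where
  open Status
  open InSync
  module Protocol (t : Th σ) = ThreadProtocol (isT t)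

  M : LTS (Act σ)
  M = Model σ T kind

  State : Set
  State = LTS.State M

  component-of : ∀ b → ∃ λ i → LTS.acts (Component σ T kind i) b
  component-of (sr t r)   = inj₂ r , a-sr t
  component-of (fr t r d) = inj₂ r , a-fr t d
  component-of (sw t r d) = inj₂ r , a-sw t d
  component-of (fw t r)   = inj₂ r , a-fw t
  component-of (or t r)   = inj₂ r , a-or t
  component-of (ow t r)   = inj₂ r , a-ow t
  component-of (loc t l)  = inj₁ t , Protocol.ThrAct⇒acts t (a-loc l)

  enabled-model : ∀ {s : State} {b} →
                  (∀ t → ThrAct σ t b → Enabled (T t) (s (inj₁ t)) b) →
                  (∀ r → RegAct σ r b → Enabled (RegisterLTS σ r (kind r)) (s (inj₂ r)) b) →
                  Enabled M s b
  enabled-model {s} {b} thread register =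
    enabled-compose (Component σ T kind) em (component-of b) component
    where
    component : ∀ i → LTS.acts (Component σ T kind i) b → Enabled (Component σ T kind i) (s i) b
    component (inj₁ t) b∈t = thread t (Protocol.acts⇒ThrAct t b∈t)
    component (inj₂ r) b∈r = register r b∈r

  register-enabled : ∀ {s : State} {r b} → Enabled M s b → RegAct σ r b →
                     ∃ λ s' → RTrans σ r (kind r) (s (inj₂ r)) b s'
  register-enabled {r = r} en = enabled-component (Component σ T kind) en (inj₂ r)

  record Invariant (s : State) : Set where
    field
      history             : ∀ t → Run (T t) (s (inj₁ t))
      in-sync             : ∀ t r → InSync r t (s (inj₂ r)) (lastAct (T t) (history t))
      readers-have-values : ∀ r → ReadersHaveValues (s (inj₂ r))

  open Invariant

  invariant-init : Invariant (LTS.init M)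
  invariant-init = record
    { history             = λ _ → run-init
    ; in-sync             = λ _ _ → sync-idle refl refl (λ ()) (λ ())
    ; readers-have-values = λ _ _ ()
    }

  ThreadHistory : State → Th σ → Set
  ThreadHistory s t =
    Σ (Run (T t) (s (inj₁ t))) λ ρ → ∀ r → InSync r t (s (inj₂ r)) (lastAct (T t) ρ)

  module _ {s b s'} (step : LTS.Trans M s b s') where

    component-moves : ∀ i → LTS.Trans (Component σ T kind i) (s i) b (s' i) ⊎
                            (¬ LTS.acts (Component σ T kind i) b × s' i ≡ s i)
    component-moves = component-step (Component σ T kind) em step

    sync-participant : ∀ {t r} (ρ : Run (T t) (s (inj₁ t))) →
                       InSync r t (s (inj₂ r)) (lastAct (T t) ρ) →
                       LTS.Trans (T t) (s (inj₁ t)) b (s' (inj₁ t)) →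
                       InSync r t (s' (inj₂ r)) (just b)
    sync-participant {t} {r} ρ sync θ =
      [ (λ register-step →
           sync-own-step register-step (Protocol.enabled⇒ThrAct t (_ , θ)) respects)
      , (λ (b∉r , unchanged) → subst (λ x → InSync r t x (just b)) (sym unchanged)
                                     (sync-foreign-step b∉r respects))
      ] (component-moves (inj₂ r))
      where
      respects : RespectsPending (s (inj₂ r)) b
      respects =
        (λ reading → Protocol.after-sr-only-fr t ρ r (reading⇒sr sync reading) b (_ , θ)) ,
        (λ writing →
           Protocol.after-sw-only-fw t ρ r (proj₂ (writing⇒sw sync writing)) b (_ , θ))

    sync-bystander : ∀ {t r last} → ¬ LTS.acts (T t) b →
                     InSync r t (s (inj₂ r)) last → InSync r t (s' (inj₂ r)) last
    sync-bystander {t} {r} {last} b∉t sync with component-moves (inj₂ r)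
    ... | inj₁ register-step =
      let (same-rds , same-wrts) =
            RTrans-preserves-other register-step (λ tb → b∉t (Protocol.ThrAct⇒acts t tb))
      in InSync-cong same-rds same-wrts sync
    ... | inj₂ (_ , unchanged) = subst (λ x → InSync r t x last) (sym unchanged) sync

    thread-step : ∀ t → ThreadHistory s t → ThreadHistory s' t
    thread-step t (ρ , sync) with component-moves (inj₁ t)
    ... | inj₁ θ = run-step ρ θ , λ r → sync-participant ρ (sync r) θ
    ... | inj₂ (b∉t , unchanged) =
      subst (Run (T t)) (sym unchanged) ρ ,
      λ r → subst (InSync r t (s' (inj₂ r))) (sym (lastAct-subst (sym unchanged) ρ))
                  (sync-bystander b∉t (sync r))

    register-step : ∀ r → ReadersHaveValues (s (inj₂ r)) → ReadersHaveValues (s' (inj₂ r))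
    register-step r ok with component-moves (inj₂ r)
    ... | inj₁ step-r          = RTrans-readersHaveValues step-r ok
    ... | inj₂ (_ , unchanged) = subst ReadersHaveValues (sym unchanged) ok

    invariant-step : Invariant s → Invariant s'
    invariant-step inv = record
      { history             = λ t → proj₁ (next t)
      ; in-sync             = λ t → proj₂ (next t)
      ; readers-have-values = λ r → register-step r (readers-have-values inv r)
      }
      where
      next : ∀ t → ThreadHistory s' t
      next t = thread-step t (history inv t , in-sync inv t)

  invariant : ∀ {s} → Run M s → Invariant s
  invariant run-init          = invariant-init
  invariant (run-step ρ step) = invariant-step step (invariant ρ)

  FinishEnabled : State → Th σ → Set
  FinishEnabled s t = ∃ λ b → NonStart t b × ¬ ThreadLocal σ b × Enabled M s b

  module _ {s : State} (inv : Invariant s) where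

    register-sees-idle : ∀ {t r a} → Enabled (T t) (s (inj₁ t)) a →
                         (∀ d → a ≢ fr t r d) → a ≢ fw t r →
                         rds (s (inj₂ r)) t ≡ false × wrts (s (inj₂ r)) t ≡ false
    register-sees-idle {t} {r} {a} en not-fr not-fw =
      ¬-not (λ reading →
        let last = reading⇒sr (in-sync inv t r) reading
            (d , a≡fr) = Protocol.after-sr-only-fr t ρ r last a en
        in not-fr d a≡fr) ,
      ¬-not (λ writing →
        let (_ , last) = writing⇒sw (in-sync inv t r) writing
        in not-fw (Protocol.after-sw-only-fw t ρ r last a en))
      where
      ρ : Run (T t) (s (inj₁ t))
      ρ = history inv t

    start-enabled : ∀ {r a} → Start σ r a → Enabled (T (thr σ a)) (s (inj₁ (thr σ a))) a →
                    Enabled M s a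
    start-enabled (st-sr t) en with register-sees-idle en (λ _ ()) (λ ())
    ... | not-reading , not-writing =
      enabled-model (λ { _ (a-sr _) → en })
                    (λ { _ (a-sr _) → _ , t-sr not-reading not-writing })
    start-enabled (st-sw t d) en with register-sees-idle en (λ _ ()) (λ ())
    ... | not-reading , not-writing =
      enabled-model (λ { _ (a-sw _ _) → en })
                    (λ { _ (a-sw _ _) → _ , t-sw d not-reading not-writing })

    reading-can-complete : ∀ {t r d} → Enabled (T t) (s (inj₁ t)) (fr t r d) → FinishEnabled s t
    reading-can-complete {t} {r} en =
      [ (λ (d , register-en) → fr t r d , ns-fr r d , (λ ()) ,
           enabled-model (λ { _ (a-fr _ _) → Protocol.after-sr-fr-enabled t ρ r last d })
                         (λ { _ (a-fr _ _) → register-en }))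
      , (λ register-en → or t r , ns-or r , (λ ()) ,
           enabled-model (λ _ ()) (λ { _ (a-or _) → register-en }))
      ] (reading-can-finish (kind r) (readers-have-values inv r) (sr⇒reading (in-sync inv t r) last))
      where
      ρ : Run (T t) (s (inj₁ t))
      ρ = history inv t
      last : lastAct (T t) ρ ≡ just (sr t r)
      last = Protocol.fr-enabled⇒after-sr t ρ r en

    writing-can-complete : ∀ {t r} → Enabled (T t) (s (inj₁ t)) (fw t r) → FinishEnabled s t
    writing-can-complete {t} {r} en with Protocol.fw-enabled⇒after-sw t (history inv t) r en
    ... | _ , last =
      [ (λ register-en → fw t r , ns-fw r , (λ ()) ,
           enabled-model (λ { _ (a-fw _) → en }) (λ { _ (a-fw _) → register-en }))
      , (λ register-en → ow t r , ns-ow r , (λ ()) ,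
           enabled-model (λ _ ()) (λ { _ (a-ow _) → register-en }))
      ] (writing-can-finish (kind r) (sw⇒writing (in-sync inv t r) last))

    or-enabled⇒fr-enabled : ∀ {t r} → Enabled M s (or t r) →
                            ∀ d → Enabled (T t) (s (inj₁ t)) (fr t r d)
    or-enabled⇒fr-enabled {t} {r} en =
      Protocol.after-sr-fr-enabled t (history inv t) r
        (reading⇒sr (in-sync inv t r) (or⇒reading (proj₂ (register-enabled en (a-or t)))))

    ow-enabled⇒fw-enabled : ∀ {t r} → Enabled M s (ow t r) →
                            Enabled (T t) (s (inj₁ t)) (fw t r)
    ow-enabled⇒fw-enabled {t} {r} en =
      let writing = ow⇒writing (proj₂ (register-enabled en (a-ow t)))
          (_ , last) = writing⇒sw (in-sync inv t r) writing
      in Protocol.after-sw-fw-enabled t (history inv t) r last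

  module Along (B : Act σ → Set) (B-local : ∀ a → B a → ThreadLocal σ a)
               (π : Path M) (fromInit : FromInit π) where
    open Path π

    invariant-at : ∀ n → n ≤L len → Invariant (st n)
    invariant-at n n≤l = invariant (reachable-along π fromInit n n≤l)

    JustS : Set
    JustS = Just M B (_⌣S_ σ) π

    OnlyStartsThreadEnabled : Set
    OnlyStartsThreadEnabled =
      ∀ a → ¬ B a → ThreadEnabled σ T kind π a → ∃ λ r → Start σ r a

    ThreadEnabledStartsRecur : Set
    ThreadEnabledStartsRecur =
      ∀ r a → Start σ r a → ThreadEnabled σ T kind π a → InfManySw σ T kind π r

    idle-thread-blocked : JustS → ∀ {t N b} → NoThreadActFrom σ T kind π t N →
                          NonStart t b → ¬ B b → ¬ Enabled M (st N) b
    idle-thread-blocked J (N≤l , idle) ns b∉B en =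
      let (i , N≤i , i<l , conflict) = J _ N≤l _ b∉B en
      in conflict (nonStart-⌣S ns (idle i N≤i i<l))

    finish-blocked : JustS → ∀ {t N} → NoThreadActFrom σ T kind π t N →
                     ¬ FinishEnabled (st N) t
    finish-blocked J idle (b , ns , not-local , en) =
      idle-thread-blocked J idle ns (λ b∈B → not-local (B-local b b∈B)) en

    thread-frozen : ∀ {t N K} → NoThreadActFrom σ T kind π t N → N ≤ K → K ≤L len →
                    st K (inj₁ t) ≡ st N (inj₁ t)
    thread-frozen {t} (_ , idle) = component-frozen (Component σ T kind) π (inj₁ t)
      λ j N≤j j<l b∈t → idle j N≤j j<l (thr-ThrAct (Protocol.acts⇒ThrAct t b∈t))

    just⇒onlyStartsThreadEnabled : JustS → OnlyStartsThreadEnabled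
    just⇒onlyStartsThreadEnabled _ (sr t r)   _ _ = r , st-sr t
    just⇒onlyStartsThreadEnabled _ (sw t r d) _ _ = r , st-sw t d
    just⇒onlyStartsThreadEnabled _ (or t r) _ (_ , _ , en) =
      case Protocol.enabled⇒ThrAct t en of λ ()
    just⇒onlyStartsThreadEnabled _ (ow t r) _ (_ , _ , en) =
      case Protocol.enabled⇒ThrAct t en of λ ()
    just⇒onlyStartsThreadEnabled J (loc t l) a∉B (_ , idle , en) =
      ⊥-elim (idle-thread-blocked J idle (ns-loc l) a∉B
                (enabled-model (λ { _ (a-loc _) → en }) (λ _ ())))
    just⇒onlyStartsThreadEnabled J (fr t r d) _ (N , idle , en) =
      ⊥-elim (finish-blocked J idle (reading-can-complete (invariant-at N (proj₁ idle)) en))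
    just⇒onlyStartsThreadEnabled J (fw t r) _ (N , idle , en) =
      ⊥-elim (finish-blocked J idle (writing-can-complete (invariant-at N (proj₁ idle)) en))

    just⇒threadEnabledStartsRecur : JustS → ThreadEnabledStartsRecur
    just⇒threadEnabledStartsRecur J r a start (N , idle , en) =
      occursAfter-from len (proj₁ idle) sw-after
      where
      a∉B : ¬ B a
      a∉B a∈B = start-not-local start (B-local a a∈B)
      enabled-later : ∀ K → N ≤ K → K ≤L len → Enabled M (st K) a
      enabled-later K N≤K K≤l =
        start-enabled (invariant-at K K≤l) start
          (subst (λ x → Enabled (T (thr σ a)) x a) (sym (thread-frozen idle N≤K K≤l)) en)
      sw-after : ∀ K → N ≤ K → K ≤L len → OccursAfter len (λ i → SwOn r (act i)) K
      sw-after K N≤K K≤l =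
        let (i , K≤i , i<l , conflict) =
              J K K≤l a a∉B (enabled-later K N≤K K≤l)
            other-thread = ≢-sym (proj₂ idle i (≤-trans N≤K K≤i) i<l)
        in i , K≤i , i<l , em⇒dne em λ ¬sw → conflict (start-⌣S start other-thread ¬sw)

    ConcurrentFrom : ℕ → Act σ → Set
    ConcurrentFrom k a = ∀ i → k ≤ i → i <L len → _⌣S_ σ a (act i)

    module _ (onlyStarts : OnlyStartsThreadEnabled) (startsRecur : ThreadEnabledStartsRecur)
             {k} (k≤l : k ≤L len) where

      concurrent⇒idle : ∀ {a} → ConcurrentFrom k a → NoThreadActFrom σ T kind π (thr σ a) k
      concurrent⇒idle concurrent =
        k≤l , λ i k≤i i<l → ≢-sym (proj₁ (concurrent i k≤i i<l))

      thread-action-conflicts : ∀ {a} → ThrAct σ (thr σ a) a → ¬ B a →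
                                Enabled M (st k) a → ¬ ConcurrentFrom k a
      thread-action-conflicts {a} ta a∉B en concurrent =
        let (r , start) = onlyStarts a a∉B thread-enabled
            (i , k≤i , i<l , later-sw) = startsRecur r a start thread-enabled k
        in start-¬⌣S-sw start later-sw (concurrent i k≤i i<l)
        where
        thread-enabled : ThreadEnabled σ T kind π a
        thread-enabled = k , concurrent⇒idle concurrent ,
          enabled-component (Component σ T kind) en (inj₁ (thr σ a)) (Protocol.ThrAct⇒acts _ ta)

      -- The thread enables fr t r d for every d; d0 is just some element of D r.
      or-conflicts : ∀ {t r} → Enabled M (st k) (or t r) → ¬ ConcurrentFrom k (or t r)
      or-conflicts {t} {r} en concurrent
        with onlyStarts (fr t r (Sig.d0 σ r)) (λ b → case B-local _ b of λ ())
               (k , concurrent⇒idle concurrent ,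
                or-enabled⇒fr-enabled (invariant-at k k≤l) en (Sig.d0 σ r))
      ... | _ , ()

      ow-conflicts : ∀ {t r} → Enabled M (st k) (ow t r) → ¬ ConcurrentFrom k (ow t r)
      ow-conflicts {t} {r} en concurrent
        with onlyStarts (fw t r) (λ b → case B-local _ b of λ ())
               (k , concurrent⇒idle concurrent , ow-enabled⇒fw-enabled (invariant-at k k≤l) en)
      ... | _ , ()

      enabled-conflicts : ∀ a → ¬ B a → Enabled M (st k) a → ¬ ConcurrentFrom k a
      enabled-conflicts (sr t r)   = thread-action-conflicts (a-sr r)
      enabled-conflicts (fr t r d) = thread-action-conflicts (a-fr r d)
      enabled-conflicts (sw t r d) = thread-action-conflicts (a-sw r d)
      enabled-conflicts (fw t r)   = thread-action-conflicts (a-fw r)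
      enabled-conflicts (loc t l)  = thread-action-conflicts (a-loc l)
      enabled-conflicts (or t r) _ = or-conflicts
      enabled-conflicts (ow t r) _ = ow-conflicts

    conditions⇒just : OnlyStartsThreadEnabled → ThreadEnabledStartsRecur → JustS
    conditions⇒just onlyStarts startsRecur k k≤l a a∉B en = em⇒dne em λ no-conflict →
      enabled-conflicts onlyStarts startsRecur k≤l a a∉B en λ i k≤i i<l →
        em⇒dne em λ ¬concurrent → no-conflict (i , k≤i , i<l , ¬concurrent)

proposition21 : ExcludedMiddle 0ℓ →
    (σ : Sig) (T : (t : Th σ) → LTS (Act σ)) → (∀ t → IsThread σ t (T t)) →
    (kind : Rg σ → Kind) →
    (B : Act σ → Set) → (∀ a → B a → ThreadLocal σ a) →
    (π : Path (Model σ T kind)) → FromInit π →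
    Just (Model σ T kind) B (_⌣S_ σ) π ⇔
    ((∀ a → ¬ B a → ThreadEnabled σ T kind π a → Σ (Rg σ) λ r → Start σ r a) ×
    (∀ r a → Start σ r a → ThreadEnabled σ T kind π a → InfManySw σ T kind π r))
proposition21 em σ T isT kind B B-local π fromInit =
  mk⇔ (λ J → just⇒onlyStartsThreadEnabled J , just⇒threadEnabledStartsRecur J)
      (λ (onlyStarts , startsRecur) → conditions⇒just onlyStarts startsRecur)
  where
  open ThreadRegisterModel em σ T isT kind
  open Along B B-local π fromInit
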